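{- Let $\boldsymbol w\in\{0,1\}^\omega$ be faux-bonacci. Then $10101$ is not a factor of ${}^-\boldsymbol w$.
   Context: ${}^-\boldsymbol w$ denotes $\boldsymbol w$ with its first letter erased. For non-empty $X$, $X^-$ is $X$ with its last letter erased; a $4^-$-power is $XXXX^-$ with $X$ non-empty; a binary word is faux-bonacci if it has no factor $11$ and no factor that is a $4^-$-power. -}

module Defs where

open import Data.Bool using (Bool; true; false)
open import Data.Nat using (ℕ; zero; suc)
open import Data.List using (List; []; _∷_; _++_; length)
open import Data.Product using (∃-syntax; _×_)
open import Relation.Binary.PropositionalEquality using (_≡_)
open import Relation.Nullary using (¬_)

-- Binary letters: false = 0, true = 1.
-- Infinite (omega-)words over {0,1}: indexed by positions 0,1,2,...
Word : Set
Word = ℕ → Bool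

slice : Word → ℕ → ℕ → List Bool
slice w i zero = []
slice w i (suc n) = w i ∷ slice w (suc i) n

IsFactor : List Bool → Word → Set
IsFactor u w = ∃[ i ] slice w i (length u) ≡ u

dropLast : {A : Set} → List A → List A
dropLast [] = []
dropLast (x ∷ []) = []
dropLast (x ∷ y ∷ l) = x ∷ dropLast (y ∷ l)

Is4⁻Power : List Bool → Set
Is4⁻Power u = ∃[ x ] ∃[ xs ]
  (u ≡ (x ∷ xs) ++ (x ∷ xs) ++ (x ∷ xs) ++ dropLast (x ∷ xs))

FauxBonacci : Word → Set
FauxBonacci w = ¬ IsFactor (true ∷ true ∷ []) w
              × (∀ u → Is4⁻Power u → ¬ IsFactor u w)

dropFirst : Word → Word
dropFirst w n = w (suc n)

{-# OPTIONS --safe #-}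
module Submission where

open import Defs
open import Data.Bool using (Bool; true; false)
open import Data.List using (List; _∷_; []; _++_; length)
open import Data.List.Properties using (∷-injectiveˡ; ∷-injectiveʳ)
open import Data.Nat using (suc; _+_)
open import Data.Nat.Properties using (+-suc)
open import Data.Empty using (⊥)
open import Data.Product using (_,_)
open import Relation.Binary.PropositionalEquality
  using (_≡_; refl; sym; trans; cong; cong₂; subst)
open import Relation.Nullary using (¬_)

-- An occurrence of 10101 in ⁻w extends to an occurrence of a10101b in w. If a or b
-- is 1 this contains 11; otherwise it is 0101010 = (01)(01)(01)0, a 4⁻-power.

slice-dropFirst : ∀ w i n → slice (dropFirst w) i n ≡ slice w (suc i) n
slice-dropFirst w i 0       = refl
slice-dropFirst w i (suc n) = cong (w (suc i) ∷_) (slice-dropFirst w (suc i) n)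

slice-snoc : ∀ w i n → slice w i (suc n) ≡ slice w i n ++ w (n + i) ∷ []
slice-snoc w i 0       = refl
slice-snoc w i (suc n) =
  cong (w i ∷_) (subst (λ k → slice w (suc i) (suc n) ≡ slice w (suc i) n ++ w k ∷ [])
                       (+-suc n i) (slice-snoc w (suc i) n))

slice-prefix : ∀ w i (u v : List Bool) →
  slice w i (length (u ++ v)) ≡ u ++ v → slice w i (length u) ≡ u
slice-prefix w i []      v p = refl
slice-prefix w i (x ∷ u) v p =
  cong₂ _∷_ (∷-injectiveˡ p) (slice-prefix w (suc i) u v (∷-injectiveʳ p))

slice-suffix : ∀ w i (u v : List Bool) →
  slice w i (length (u ++ v)) ≡ u ++ v → slice w (length u + i) (length v) ≡ v
slice-suffix w i []      v p = p
slice-suffix w i (x ∷ u) v p =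
  subst (λ j → slice w j (length v) ≡ v) (+-suc (length u) i)
        (slice-suffix w (suc i) u v (∷-injectiveʳ p))

IsFactor-infix : ∀ (u v x : List Bool) w → IsFactor (u ++ v ++ x) w → IsFactor v w
IsFactor-infix u v x w (i , p) =
  length u + i , slice-prefix w (length u + i) v x (slice-suffix w i u (v ++ x) p)

lemma2 : (w : Word) → FauxBonacci w →
    ¬ IsFactor (true ∷ false ∷ true ∷ false ∷ true ∷ []) (dropFirst w)
lemma2 w (no11 , no4⁻Power) (i , p) = excluded (w i) (w (6 + i)) window
  where
  u : List Bool
  u = true ∷ false ∷ true ∷ false ∷ true ∷ []

  window : slice w i 7 ≡ w i ∷ u ++ w (6 + i) ∷ []
  window = cong (w i ∷_) (trans (slice-snoc w (suc i) 5)
                                (cong (_++ w (6 + i) ∷ []) (trans (sym (slice-dropFirst w i 5)) p)))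

  excluded : ∀ a b → slice w i 7 ≡ a ∷ u ++ b ∷ [] → ⊥
  excluded true  b     q = no11 (IsFactor-infix [] _ (false ∷ true ∷ false ∷ true ∷ b ∷ []) w (i , q))
  excluded false true  q = no11 (IsFactor-infix (false ∷ true ∷ false ∷ true ∷ false ∷ []) _ [] w (i , q))
  excluded false false q = no4⁻Power _ (false , true ∷ [] , refl) (i , q)
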